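{- Let $q>2$ and $n\ge1$ be integers, $h\in\{0,\ldots,n\}$, and $\lambda=(q-1)n-qh$. Suppose that $$\sum_{i=0}^{k} r^k_{i,h-k}\,P^{(q-1)}_i(l;k)\neq 0\qquad\text{for all } k=0,\ldots,h \text{ and } l=0,\ldots,k.$$ Then for every function $\varphi:W_h\to\mathbb{C}$, a $\lambda$-function $f$ with $f(\alpha)=\varphi(\alpha)$ for all $\alpha\in W_h$ is uniquely determined by $\varphi$; that is, if $f,g$ are $\lambda$-functions with $f=g$ on $W_h$, then $f=g$ on all of $\mathbf{F}_q^n$.
   Context: $\mathbf{F}_q=\{0,\ldots,q-1\}$ is the additive group of integers mod $q$; $\mathbf{F}_q^n$ is the vertex set of the $q$-ary Hamming graph (adjacency: differing in exactly one coordinate). $\rho$ is Hamming distance, $W_h=\{\alpha:\rho(\alpha,\mathbf{0})=h\}$, $W_1(\alpha)=\{\beta:\rho(\alpha,\beta)=1\}$. A $\lambda$-function is $f:\mathbf{F}_q^n\to\mathbb{C}$ with $\sum_{\beta\in W_1(\alpha)}f(\beta)=\lambda f(\alpha)$ for all $\alpha$. For $p\ge2$, $P^{(p)}_i(t;N)=\sum_{s=0}^{i}(-1)^s(p-1)^{i-s}\binom{t}{s}\binom{N-t}{i-s}$ (Krawtchouk polynomial); binomials with $b<0$ or $b>a\ge0$ are $0$ and empty sums are $0$. For $0\le k\le h$ and integers $i\ge0$, $0\le j\le n-k$, the coefficients $r^k_{ij}$ are: if $k\le n-h$, $r^k_{ij}=(-1)^i\sum_{l=0}^{j-i}P^{(q)}_{j-i-l}(h-k;n-2k)(q-2)^l\binom{k-i}{l}$;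 if $k>n-h$, let $U=(u_{ab})_{a,b=0}^{n-k}$ with $u_{ab}=(q-1)^{a-b}\binom{h+k-n}{a-b}$ (lower triangular, unit diagonal), $U^{ -1}=(u'_{ab})$, and $r^k_{ij}=(-1)^i\sum_{s=i}^{j}u'_{js}P^{(q-1)}_{s-i}(h-k;h-i)$. (In both cases $r^k_{ij}=0$ for $i>j$.) -}

module Defs where

open import Level using (Level)
open import Data.Nat as ℕ using (ℕ; zero; suc; _∸_; _≤ᵇ_; _<ᵇ_; _≡ᵇ_)
open import Data.Nat.Combinatorics using (_C_)
open import Data.Integer as ℤ using (ℤ; +_; -[1+_])
open import Data.Bool using (if_then_else_)
open import Data.Fin as Fin using (Fin; toℕ)
open import Data.Vec using (Vec; _[_]≔_; lookup; count)
open import Data.Product using (∃; _,_)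
open import Relation.Nullary using (¬_; ¬?; does)
open import Relation.Binary.PropositionalEquality using (_≡_; _≢_)
open import Algebra.Bundles using (CommutativeRing)

sumℤ : ℕ → (ℕ → ℤ) → ℤ
sumℤ zero    f = + 0
sumℤ (suc m) f = sumℤ m f ℤ.+ f m

Σ0to : ℕ → (ℕ → ℤ) → ℤ
Σ0to m f = sumℤ (suc m) f

sgn : ℕ → ℤ
sgn zero    = + 1
sgn (suc s) = ℤ.- sgn s

binom : ℕ → ℕ → ℤ
binom a b = + (a C b)

powℤ : ℕ → ℕ → ℤ
powℤ a e = + (a ℕ.^ e)

-- Krawtchouk polynomial P^{(p)}_i(t;N)
--   = Σ_{s=0}^{i} (-1)^s (p-1)^{i-s} C(t,s) C(N-t,i-s)
-- (only used with t ≤ N, so N ∸ t is the true difference N - t)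
kraw : (p i t N : ℕ) → ℤ
kraw p i t N = Σ0to i (λ s → sgn s ℤ.* powℤ (p ∸ 1) (i ∸ s) ℤ.* binom t s ℤ.* binom (N ∸ t) (i ∸ s))

uEntry : (q m a b : ℕ) → ℤ
uEntry q m a b = if b ≤ᵇ a then powℤ (q ∸ 1) (a ∸ b) ℤ.* binom m (a ∸ b) else + 0

δ : ℕ → ℕ → ℤ
δ a b = if a ≡ᵇ b then + 1 else + 0

-- Inverse of the unit lower-triangular matrix U, by forward substitution
-- (the unique solution of U U' = I):
--   u'_ab = δ_ab - Σ_{c<a} u_ac u'_cb .
-- invTable q m a c b = u'_cb, valid for c ≤ a.
invTable : (q m a : ℕ) → ℕ → ℕ → ℤ
invTable q m zero    c b = δ 0 b
invTable q m (suc a) c b =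
  if c ≤ᵇ a then invTable q m a c b
  else δ (suc a) b ℤ.- sumℤ (suc a) (λ c′ → uEntry q m (suc a) c′ ℤ.* invTable q m a c′ b)

uInv : (q m a b : ℕ) → ℤ
uInv q m a b = invTable q m a a b

r : (q n h k i j : ℕ) → ℤ
r q n h k i j =
  if j <ᵇ i then + 0 else
  (if k ℕ.+ h ≤ᵇ n
   then sgn i ℤ.* Σ0to (j ∸ i) (λ l →
          kraw q (j ∸ i ∸ l) (h ∸ k) (n ∸ 2 ℕ.* k) ℤ.* powℤ (q ∸ 2) l ℤ.* binom (k ∸ i) l)
   else sgn i ℤ.* Σ0to (j ∸ i) (λ t →
          uInv q (h ℕ.+ k ∸ n) j (i ℕ.+ t) ℤ.* kraw (q ∸ 1) t (h ∸ k) (h ∸ i)))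

NonDegenerate : (q n h : ℕ) → Set
NonDegenerate q n h =
  ∀ k l → k ℕ.≤ h → l ℕ.≤ k →
    Σ0to k (λ i → r q n h k i (h ∸ k) ℤ.* kraw (q ∸ 1) i l k) ≢ + 0

weight : ∀ {q n} → Vec (Fin q) n → ℕ
weight = count (λ x → ¬? (toℕ x ℕ.≟ 0))

-- Scalars: a field of characteristic zero (stands in for ℂ)

module _ {c ℓ : Level} (R : CommutativeRing c ℓ) where
  open CommutativeRing R

  natCast : ℕ → Carrier
  natCast zero    = 0#
  natCast (suc m) = 1# + natCast m

  intCast : ℤ → Carrier
  intCast (+ m)      = natCast m
  intCast -[1+ m ]   = - natCast (suc m)

  record IsFieldChar0 : Set (c Level.⊔ ℓ) where
    field
      nontrivial : ¬ (1# ≈ 0#)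
      inverse    : ∀ x → ¬ (x ≈ 0#) → ∃ λ y → x * y ≈ 1#
      char0      : ∀ m → natCast m ≈ 0# → m ≡ 0

  ΣFin : (m : ℕ) → (Fin m → Carrier) → Carrier
  ΣFin zero    f = 0#
  ΣFin (suc m) f = f Fin.zero + ΣFin m (λ i → f (Fin.suc i))

  -- Σ_{β ∈ W_1(α)} f β : change one coordinate i to a value a ≠ α_i
  neighbourSum : ∀ {q n} → (Vec (Fin q) n → Carrier) → Vec (Fin q) n → Carrier
  neighbourSum {q} {n} f α =
    ΣFin n (λ i → ΣFin q (λ a →
      if does (a Fin.≟ lookup α i) then 0# else f (α [ i ]≔ a)))

  IsLambdaFunction : ∀ q n → ℤ → (Vec (Fin q) n → Carrier) → Set ℓ
  IsLambdaFunction q n λ′ f = ∀ α → neighbourSum f α ≈ intCast λ′ * f α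

module Submission where

-- Uniqueness of λ-functions of the q-ary Hamming graph (q > 2) from their
-- values on W_h; the nondegeneracy hypothesis turns out to be unnecessary.
-- With p = q - 1 and "level j" meaning the eigenvalue p·n - q·j (j ∈ ℤ), we
-- prove by induction on n: an eigenfunction of level j vanishing on the
-- words of weight j vanishes.
--   1. Symmetry: two slices of f (one coordinate fixed to nonzero values)
--      differ by an eigenfunction of length n - 1 and level j - 1 vanishing
--      on weight j - 1, so by induction f depends only on supports.
--   2. Boolean cube: there the adjacency operator becomes a support
--      operator, diagonalised by the Kronecker power of ((1, p), (1, -1)).
--      So this transform of f vanishes off weight j; f vanishes on weight j.
--   3. Elimination: these two kinds of rows form an integer matrix that is
--      triangular modulo p with unit diagonal, invertible in characteristic 0.
-- In order: the cast ℤ → R, units mod p, elimination, sums, the Boolean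
-- cube, the Hamming graph, and the theorem as a consequence.

open import Defs
open import Level using (Level)
open import Function using (_∘_; _$_)
open import Data.Bool using (Bool; true; false; if_then_else_)
open import Data.Empty using (⊥-elim)
open import Data.Unit using (⊤; tt)
open import Data.Product using (_,_)
open import Data.Sum using (inj₁; inj₂)
open import Data.Maybe using (Maybe; just; nothing)
open import Data.Nat as ℕ using (ℕ; zero; suc; _≤_; _<_; _∸_)
import Data.Nat.Properties as ℕP
import Data.Nat.Divisibility as ℕDiv
open import Data.Integer as ℤ using (ℤ; +_; -[1+_]; _⊖_; 0ℤ; 1ℤ; -1ℤ)
import Data.Integer.Properties as ℤP
open import Data.Integer.Divisibility.Signed
  using (_∣_; divides; ∣m∣n⇒∣m+n; ∣m∣n⇒∣m-n; ∣n⇒∣m*n; ∣m⇒∣m*n; ∣m⇒∣-m; ∣⇒∣ᵤ)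
open import Data.Integer.Tactic.RingSolver using (solve-∀)
open import Data.Fin as Fin using (Fin)
open import Data.Vec as Vec using (Vec; []; _∷_; lookup; _[_]≔_)
import Data.Vec.Properties as VecP
open import Data.List as List using (List; []; _∷_; _++_)
open import Data.List.Relation.Unary.All as All using (All; []; _∷_)
import Data.List.Relation.Unary.All.Properties as AllP
open import Relation.Nullary using (¬_; Dec; yes; no; does)
open import Relation.Nullary.Decidable using (map′)
open import Relation.Binary.PropositionalEquality as ≡ using (_≡_; _≢_)
open import Algebra.Bundles using (CommutativeRing)
import Algebra.Solver.Ring
open import Algebra.Solver.Ring.AlmostCommutativeRing
  using (fromCommutativeRing; _-Raw-AlmostCommutative⟶_)

-- This lets us
-- move integer identities into R and run the ring solver over R with
-- integer coefficients (so that cancellations like x - x = 0 are seen).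
module IntegerCast {c ℓ : Level} (R : CommutativeRing c ℓ) where
  open CommutativeRing R
  open import Algebra.Properties.Ring ring
    using (-0#≈0#; -‿involutive; -‿+-comm; -‿distribˡ-*; -‿distribʳ-*)
  open import Algebra.Properties.CommutativeSemigroup +-commutativeSemigroup
    using (interchange)
  open import Algebra.Definitions.RawMonoid +-rawMonoid using (_×_)
  open import Algebra.Properties.Monoid.Mult +-monoid using (×-homo-+)
  open import Algebra.Properties.Semiring.Mult semiring using (×1-homo-*)
  open import Relation.Binary.Reasoning.Setoid setoid

  ι : ℤ → Carrier
  ι = intCast R

  natCast≈× : ∀ m → natCast R m ≈ m × 1#
  natCast≈× zero    = refl
  natCast≈× (suc m) = +-congˡ (natCast≈× m)

  natCast-+ : ∀ m n → natCast R (m ℕ.+ n) ≈ natCast R m + natCast R n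
  natCast-+ m n = begin
    natCast R (m ℕ.+ n)    ≈⟨ natCast≈× (m ℕ.+ n) ⟩
    (m ℕ.+ n) × 1#         ≈⟨ ×-homo-+ 1# m n ⟩
    m × 1# + n × 1#        ≈⟨ +-cong (natCast≈× m) (natCast≈× n) ⟨
    natCast R m + natCast R n ∎

  natCast-* : ∀ m n → natCast R (m ℕ.* n) ≈ natCast R m * natCast R n
  natCast-* m n = begin
    natCast R (m ℕ.* n)    ≈⟨ natCast≈× (m ℕ.* n) ⟩
    (m ℕ.* n) × 1#         ≈⟨ ×1-homo-* m n ⟩
    m × 1# * n × 1#        ≈⟨ *-cong (natCast≈× m) (natCast≈× n) ⟨
    natCast R m * natCast R n ∎

  ι-neg : ∀ z → ι (ℤ.- z) ≈ - ι z
  ι-neg (+ zero)  = sym -0#≈0#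
  ι-neg (+ suc m) = refl
  ι-neg -[1+ m ]  = sym (-‿involutive _)

  shift-difference : ∀ x y → (1# + x) - (1# + y) ≈ x - y
  shift-difference x y = begin
    (1# + x) - (1# + y)       ≈⟨ +-congˡ (-‿+-comm 1# y) ⟨
    (1# + x) + (- 1# - y)     ≈⟨ interchange 1# x (- 1#) (- y) ⟩
    (1# - 1#) + (x - y)       ≈⟨ +-congʳ (-‿inverseʳ 1#) ⟩
    0# + (x - y)              ≈⟨ +-identityˡ _ ⟩
    x - y                     ∎

  ι-⊖ : ∀ m n → ι (m ⊖ n) ≈ natCast R m - natCast R n
  ι-⊖ zero    zero    = sym (-‿inverseʳ 0#)
  ι-⊖ zero    (suc n) = sym (+-identityˡ _)
  ι-⊖ (suc m) zero    = sym (trans (+-congˡ -0#≈0#) (+-identityʳ _))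
  ι-⊖ (suc m) (suc n) = begin
    ι (suc m ⊖ suc n)                    ≡⟨ ≡.cong ι (ℤP.[1+m]⊖[1+n]≡m⊖n m n) ⟩
    ι (m ⊖ n)                            ≈⟨ ι-⊖ m n ⟩
    natCast R m - natCast R n            ≈⟨ shift-difference _ _ ⟨
    natCast R (suc m) - natCast R (suc n) ∎

  ι-+ : ∀ i j → ι (i ℤ.+ j) ≈ ι i + ι j
  ι-+ (+ m)    (+ n)    = natCast-+ m n
  ι-+ (+ m)    -[1+ n ] = ι-⊖ m (suc n)
  ι-+ -[1+ m ] (+ n)    = trans (ι-⊖ n (suc m)) (+-comm _ _)
  ι-+ -[1+ m ] -[1+ n ] = begin
    - natCast R (suc (suc (m ℕ.+ n)))        ≡⟨ ≡.cong (λ k → - natCast R k) (ℕP.+-suc (suc m) n) ⟨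
    - natCast R (suc m ℕ.+ suc n)            ≈⟨ -‿cong (natCast-+ (suc m) (suc n)) ⟩
    - (natCast R (suc m) + natCast R (suc n)) ≈⟨ -‿+-comm _ _ ⟨
    - natCast R (suc m) - natCast R (suc n)  ∎

  ι-* : ∀ i j → ι (i ℤ.* j) ≈ ι i * ι j
  ι-* (+ m) (+ n) = trans (reflexive (≡.cong ι (≡.sym (ℤP.pos-* m n)))) (natCast-* m n)
  ι-* (+ m) -[1+ n ] = begin
    ι (+ m ℤ.* -[1+ n ])                 ≡⟨ ≡.cong ι (ℤP.neg-distribʳ-* (+ m) (+ suc n)) ⟨
    ι (ℤ.- (+ m ℤ.* + suc n))            ≈⟨ ι-neg (+ m ℤ.* + suc n) ⟩
    - ι (+ m ℤ.* + suc n)                ≈⟨ -‿cong (ι-* (+ m) (+ suc n)) ⟩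
    - (ι (+ m) * ι (+ suc n))            ≈⟨ -‿distribʳ-* _ _ ⟩
    ι (+ m) * - ι (+ suc n)              ∎
  ι-* -[1+ m ] (+ n) = begin
    ι (-[1+ m ] ℤ.* + n)                 ≡⟨ ≡.cong ι (ℤP.neg-distribˡ-* (+ suc m) (+ n)) ⟨
    ι (ℤ.- (+ suc m ℤ.* + n))            ≈⟨ ι-neg (+ suc m ℤ.* + n) ⟩
    - ι (+ suc m ℤ.* + n)                ≈⟨ -‿cong (ι-* (+ suc m) (+ n)) ⟩
    - (ι (+ suc m) * ι (+ n))            ≈⟨ -‿distribˡ-* _ _ ⟩
    - ι (+ suc m) * ι (+ n)              ∎
  ι-* -[1+ m ] -[1+ n ] = begin
    ι (+ suc m ℤ.* + suc n)              ≈⟨ ι-* (+ suc m) (+ suc n) ⟩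
    ι (+ suc m) * ι (+ suc n)            ≈⟨ -‿involutive _ ⟨
    - - (ι (+ suc m) * ι (+ suc n))      ≈⟨ -‿cong (-‿distribʳ-* _ _) ⟩
    - (ι (+ suc m) * - ι (+ suc n))      ≈⟨ -‿distribˡ-* _ _ ⟩
    - ι (+ suc m) * - ι (+ suc n)        ∎

  ι-homomorphism : ℤ.+-*-rawRing -Raw-AlmostCommutative⟶ fromCommutativeRing R
  ι-homomorphism = record
    { ⟦_⟧ = ι ; +-homo = ι-+ ; *-homo = ι-* ; -‿homo = ι-neg
    ; 0-homo = refl ; 1-homo = +-identityʳ 1# }

  ι-equal? : ∀ x y → Maybe (ι x ≈ ι y)
  ι-equal? x y with x ℤ.≟ y
  ... | yes ≡.refl = just refl
  ... | no _       = nothing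

  open Algebra.Solver.Ring ℤ.+-*-rawRing (fromCommutativeRing R) ι-homomorphism ι-equal? public
    using (solve; _:=_; _:+_; _:*_; _:-_; :-_; con)

module UnitsModulo (p : ℕ) where

  record Unit (z : ℤ) : Set where
    constructor unit
    field
      inverse    : ℤ
      invertible : + p ∣ z ℤ.* inverse ℤ.- 1ℤ

  unit-1 : Unit 1ℤ
  unit-1 = unit 1ℤ (divides 0ℤ ≡.refl)

  unit--1 : Unit -1ℤ
  unit--1 = unit -1ℤ (divides 0ℤ ≡.refl)

  unit-* : ∀ {a b} → Unit a → Unit b → Unit (a ℤ.* b)
  unit-* {a} {b} (unit u a∣) (unit v b∣) =
    unit (u ℤ.* v) $ ≡.subst (+ p ∣_) (≡.sym (expand a b u v)) (∣m∣n⇒∣m+n (∣m⇒∣m*n (b ℤ.* v) a∣) b∣)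
    where
    expand : ∀ a b u v →
      a ℤ.* b ℤ.* (u ℤ.* v) ℤ.- 1ℤ ≡ (a ℤ.* u ℤ.- 1ℤ) ℤ.* (b ℤ.* v) ℤ.+ (b ℤ.* v ℤ.- 1ℤ)
    expand = solve-∀

  unit-minus-multiple : ∀ {a b} → Unit a → + p ∣ b → Unit (a ℤ.- b)
  unit-minus-multiple {a} {b} (unit u a∣) p∣b =
    unit u $ ≡.subst (+ p ∣_) (≡.sym (expand a b u)) (∣m∣n⇒∣m-n a∣ (∣m⇒∣m*n u p∣b))
    where
    expand : ∀ a b u → (a ℤ.- b) ℤ.* u ℤ.- 1ℤ ≡ (a ℤ.* u ℤ.- 1ℤ) ℤ.- b ℤ.* u
    expand = solve-∀

  unit-nonzero : 2 ≤ p → ∀ {z} → Unit z → z ≢ 0ℤ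
  unit-nonzero 2≤p (unit u p∣) ≡.refl =
    ℕP.<⇒≱ 2≤p (ℕDiv.∣⇒≤ (∣⇒∣ᵤ (∣m⇒∣-m p∣)))

module FieldFacts {c ℓ : Level} (R : CommutativeRing c ℓ) (F0 : IsFieldChar0 R) where
  open CommutativeRing R
  open IsFieldChar0 F0
  open IntegerCast R using (ι)
  open import Algebra.Properties.Ring ring using (-0#≈0#; -‿involutive)
  open import Relation.Binary.Reasoning.Setoid setoid

  ι≈0⇒≡0 : ∀ z → ι z ≈ 0# → z ≡ 0ℤ
  ι≈0⇒≡0 (+ m)    ιz≈0 = ≡.cong +_ (char0 m ιz≈0)
  ι≈0⇒≡0 -[1+ m ] ιz≈0
    with () ← char0 (suc m) (trans (sym (-‿involutive _)) (trans (-‿cong ιz≈0) -0#≈0#))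

  cancel : ∀ {a x} → ¬ (a ≈ 0#) → a * x ≈ 0# → x ≈ 0#
  cancel {a} {x} a≉0 ax≈0 with inverse a a≉0
  ... | a⁻¹ , aa⁻¹≈1 = begin
    x                ≈⟨ *-identityˡ x ⟨
    1# * x           ≈⟨ *-congʳ aa⁻¹≈1 ⟨
    (a * a⁻¹) * x    ≈⟨ *-congʳ (*-comm a a⁻¹) ⟩
    (a⁻¹ * a) * x    ≈⟨ *-assoc a⁻¹ a x ⟩
    a⁻¹ * (a * x)    ≈⟨ *-congˡ ax≈0 ⟩
    a⁻¹ * 0#         ≈⟨ zeroʳ a⁻¹ ⟩
    0#               ∎

  ι-cancel : ∀ {z x} → z ≢ 0ℤ → ι z * x ≈ 0# → x ≈ 0#
  ι-cancel z≢0 = cancel (λ ιz≈0 → z≢0 (ι≈0⇒≡0 _ ιz≈0))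

module ListSum {c ℓ : Level} (R : CommutativeRing c ℓ) where
  open CommutativeRing R
  open IntegerCast R using (solve; _:=_; _:+_; _:*_; _:-_; con)
  open import Algebra.Properties.CommutativeSemigroup +-commutativeSemigroup
    using (interchange)

  ΣL : {A : Set} → List A → (A → Carrier) → Carrier
  ΣL []       g = 0#
  ΣL (x ∷ xs) g = g x + ΣL xs g

  ΣL-cong : {A : Set} (xs : List A) {g h : A → Carrier} → (∀ x → g x ≈ h x) → ΣL xs g ≈ ΣL xs h
  ΣL-cong []       g≈h = refl
  ΣL-cong (x ∷ xs) g≈h = +-cong (g≈h x) (ΣL-cong xs g≈h)

  ΣL-+ : {A : Set} (xs : List A) (g h : A → Carrier) → ΣL xs (λ x → g x + h x) ≈ ΣL xs g + ΣL xs h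
  ΣL-+ []       g h = sym (+-identityʳ 0#)
  ΣL-+ (x ∷ xs) g h = trans (+-congˡ (ΣL-+ xs g h)) (interchange _ _ _ _)

  ΣL-combination : {A : Set} (xs : List A) (a b : Carrier) (g h : A → Carrier) →
    ΣL xs (λ x → a * g x - b * h x) ≈ a * ΣL xs g - b * ΣL xs h
  ΣL-combination []       a b g h = solve 2 (λ a b → con 0ℤ := a :* con 0ℤ :- b :* con 0ℤ) refl a b
  ΣL-combination (x ∷ xs) a b g h = trans (+-congˡ (ΣL-combination xs a b g h))
    (solve 6 (λ a b g h G H → (a :* g :- b :* h) :+ (a :* G :- b :* H) := a :* (g :+ G) :- b :* (h :+ H))
      refl a b (g x) (h x) (ΣL xs g) (ΣL xs h))

  ΣL-zero : {A : Set} (xs : List A) (g : A → Carrier) → All (λ x → g x ≈ 0#) xs → ΣL xs g ≈ 0#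
  ΣL-zero []       g []             = refl
  ΣL-zero (x ∷ xs) g (gx≈0 ∷ rest) = trans (+-cong gx≈0 (ΣL-zero xs g rest)) (+-identityʳ 0#)

  ΣL-++ : {A : Set} (xs ys : List A) (g : A → Carrier) → ΣL (xs ++ ys) g ≈ ΣL xs g + ΣL ys g
  ΣL-++ []       ys g = sym (+-identityˡ _)
  ΣL-++ (x ∷ xs) ys g = trans (+-congˡ (ΣL-++ xs ys g)) (sym (+-assoc _ _ _))

  ΣL-map : {A B : Set} (f : A → B) (xs : List A) (g : B → Carrier) → ΣL (List.map f xs) g ≈ ΣL xs (g ∘ f)
  ΣL-map f []       g = refl
  ΣL-map f (x ∷ xs) g = +-congˡ (ΣL-map f xs g)

-- Gaussian elimination modulo p.  An integer matrix M, listed along an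
-- order xs of its index set, is "triangular modulo p" if every diagonal
-- entry is a unit modulo p and every entry to the right of the diagonal
-- is divisible by p.  Such a matrix has nonzero determinant, so in a
-- field of characteristic zero the system M v = 0 has only v = 0.  We
-- prove this directly by eliminating one pivot at a time.
module Elimination {c ℓ : Level} (R : CommutativeRing c ℓ) (F0 : IsFieldChar0 R)
                   (p : ℕ) (2≤p : 2 ≤ p) where
  open CommutativeRing R
  open IntegerCast R
  open FieldFacts R F0
  open ListSum R
  open UnitsModulo p
  open import Data.Product using (_×_)
  open import Relation.Binary.Reasoning.Setoid setoid

  Triangular : {I : Set} → (I → I → ℤ) → List I → Set
  Triangular M []       = ⊤
  Triangular M (x ∷ xs) = Unit (M x x) × All (λ y → + p ∣ M x y) xs × Triangular M xs

  Solves : {I : Set} → (I → I → ℤ) → List I → (I → Carrier) → Set ℓ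
  Solves M xs v = All (λ x → ΣL xs (λ y → ι (M x y) * v y) ≈ 0#) xs

  module _ {I : Set} (M : I → I → ℤ) (x₀ : I) where

    -- The matrix left after using row x₀ to clear column x₀.
    pivoted : I → I → ℤ
    pivoted y z = M x₀ x₀ ℤ.* M y z ℤ.- M y x₀ ℤ.* M x₀ z

    -- Modulo p, pivoting multiplies the remaining rows by the unit M x₀ x₀.
    pivoted-triangular : ∀ ys → Unit (M x₀ x₀) → All (λ y → + p ∣ M x₀ y) ys →
      Triangular M ys → Triangular pivoted ys
    pivoted-triangular []       _    _              _ = tt
    pivoted-triangular (y ∷ zs) unit₀ (p∣y ∷ p∣zs) (unit-y , p∣row , tri) =
      unit-minus-multiple (unit-* unit₀ unit-y) (∣n⇒∣m*n (M y x₀) p∣y) ,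
      All.zipWith (λ (p∣yz , p∣x₀z) → ∣m∣n⇒∣m-n (∣n⇒∣m*n (M x₀ x₀) p∣yz) (∣n⇒∣m*n (M y x₀) p∣x₀z))
        (p∣row , p∣zs) ,
      pivoted-triangular zs unit₀ p∣zs tri

    -- Row y of the pivoted system is M x₀ x₀ · (row y) - M y x₀ · (row x₀).
    pivoted-solves : ∀ ys v → Solves M (x₀ ∷ ys) v → Solves pivoted ys v
    pivoted-solves ys v (row₀ ∷ rows) = All.map (λ {y} → pivot-row y) rows
      where
      S : I → Carrier
      S x = ΣL ys (λ z → ι (M x z) * v z)
      pivot-row : ∀ y → ι (M y x₀) * v x₀ + S y ≈ 0# → ΣL ys (λ z → ι (pivoted y z) * v z) ≈ 0#
      pivot-row y row-y = begin
        ΣL ys (λ z → ι (pivoted y z) * v z)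
          ≈⟨ ΣL-cong ys entry ⟩
        ΣL ys (λ z → ι (M x₀ x₀) * (ι (M y z) * v z) - ι (M y x₀) * (ι (M x₀ z) * v z))
          ≈⟨ ΣL-combination ys _ _ _ _ ⟩
        ι (M x₀ x₀) * S y - ι (M y x₀) * S x₀
          ≈⟨ solve 5 (λ a b c s t → a :* s :- b :* t := a :* (b :* c :+ s) :- b :* (a :* c :+ t))
               refl (ι (M x₀ x₀)) (ι (M y x₀)) (v x₀) (S y) (S x₀) ⟩
        ι (M x₀ x₀) * (ι (M y x₀) * v x₀ + S y) - ι (M y x₀) * (ι (M x₀ x₀) * v x₀ + S x₀)
          ≈⟨ +-cong (*-congˡ row-y) (-‿cong (*-congˡ row₀)) ⟩
        ι (M x₀ x₀) * 0# - ι (M y x₀) * 0#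
          ≈⟨ solve 2 (λ a b → a :* con 0ℤ :- b :* con 0ℤ := con 0ℤ) refl _ _ ⟩
        0# ∎
        where
        entry : ∀ z → ι (pivoted y z) * v z
                    ≈ ι (M x₀ x₀) * (ι (M y z) * v z) - ι (M y x₀) * (ι (M x₀ z) * v z)
        entry z = begin
          ι (pivoted y z) * v z
            ≈⟨ *-congʳ (trans (ι-+ (M x₀ x₀ ℤ.* M y z) (ℤ.- (M y x₀ ℤ.* M x₀ z)))
                 (+-cong (ι-* (M x₀ x₀) (M y z))
                   (trans (ι-neg (M y x₀ ℤ.* M x₀ z)) (-‿cong (ι-* (M y x₀) (M x₀ z)))))) ⟩
          (ι (M x₀ x₀) * ι (M y z) - ι (M y x₀) * ι (M x₀ z)) * v z
            ≈⟨ solve 5 (λ a b c d x → (a :* b :- c :* d) :* x := a :* (b :* x) :- c :* (d :* x))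
                 refl _ _ _ _ _ ⟩
          ι (M x₀ x₀) * (ι (M y z) * v z) - ι (M y x₀) * (ι (M x₀ z) * v z) ∎

  triangular-only-trivial : {I : Set} (M : I → I → ℤ) (xs : List I) (v : I → Carrier) →
    Triangular M xs → Solves M xs v → All (λ x → v x ≈ 0#) xs
  triangular-only-trivial M []        v _ _ = []
  triangular-only-trivial M (x₀ ∷ ys) v (unit₀ , p∣row , tri) solves@(row₀ ∷ _) =
    v₀≈0 ∷ rest≈0
    where
    rest≈0 : All (λ y → v y ≈ 0#) ys
    rest≈0 = triangular-only-trivial (pivoted M x₀) ys v
      (pivoted-triangular M x₀ ys unit₀ p∣row tri) (pivoted-solves M x₀ ys v solves)
    v₀≈0 : v x₀ ≈ 0#
    v₀≈0 = ι-cancel (unit-nonzero 2≤p unit₀) (begin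
      ι (M x₀ x₀) * v x₀         ≈⟨ +-identityʳ _ ⟨
      ι (M x₀ x₀) * v x₀ + 0#
        ≈⟨ +-congˡ (ΣL-zero ys _ (All.map (λ vy≈0 → trans (*-congˡ vy≈0) (zeroʳ _)) rest≈0)) ⟨
      ι (M x₀ x₀) * v x₀ + ΣL ys (λ y → ι (M x₀ y) * v y) ≈⟨ row₀ ⟩
      0#                         ∎)

  triangular-++ : {I : Set} (M : I → I → ℤ) (xs ys : List I) → Triangular M xs → Triangular M ys →
    All (λ x → All (λ y → + p ∣ M x y) ys) xs → Triangular M (xs ++ ys)
  triangular-++ M []       ys _                        tri-ys _             = tri-ys
  triangular-++ M (x ∷ xs) ys (unit-x , p∣row , tri-xs) tri-ys (p∣x ∷ p∣xs) =
    unit-x , AllP.++⁺ p∣row p∣x , triangular-++ M xs ys tri-xs tri-ys p∣xs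

  triangular-map : {I J : Set} (g : I → J) (M : J → J → ℤ) (xs : List I) →
    Triangular (λ x y → M (g x) (g y)) xs → Triangular M (List.map g xs)
  triangular-map g M []       _                      = tt
  triangular-map g M (x ∷ xs) (unit-x , p∣row , tri) =
    unit-x , AllP.map⁺ p∣row , triangular-map g M xs tri

  triangular-scale : {I : Set} (d : I → ℤ) (M : I → I → ℤ) (xs : List I) → (∀ x → Unit (d x)) →
    Triangular M xs → Triangular (λ x y → d x ℤ.* M x y) xs
  triangular-scale d M []       units _                      = tt
  triangular-scale d M (x ∷ xs) units (unit-x , p∣row , tri) =
    unit-* (units x) unit-x , All.map (∣n⇒∣m*n (d x)) p∣row , triangular-scale d M xs units tri

module FinSum {c ℓ : Level} (R : CommutativeRing c ℓ) where
  open CommutativeRing R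
  open IntegerCast R using (natCast≈×)
  open import Algebra.Properties.CommutativeMonoid.Sum +-commutativeMonoid
    using (sum; sum-cong-≋; ∑-distrib-+; sum-remove; sum-replicate)
  open import Algebra.Properties.Semiring.Sum semiring using (*-distribˡ-sum)
  open import Algebra.Properties.Semiring.Mult semiring using (_×_; ×-assoc-*; ×-congʳ)
  open import Algebra.Properties.Ring ring using (-1*x≈-x)
  open import Relation.Binary.Reasoning.Setoid setoid

  ΣFin≡sum : ∀ m (f : Fin m → Carrier) → ΣFin R m f ≡ sum f
  ΣFin≡sum zero    f = ≡.refl
  ΣFin≡sum (suc m) f = ≡.cong (_+_ (f Fin.zero)) (ΣFin≡sum m (f ∘ Fin.suc))

  ΣFin-cong : ∀ m {f g : Fin m → Carrier} → (∀ i → f i ≈ g i) → ΣFin R m f ≈ ΣFin R m g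
  ΣFin-cong m {f} {g} f≈g = begin
    ΣFin R m f   ≡⟨ ΣFin≡sum m f ⟩
    sum f        ≈⟨ sum-cong-≋ f≈g ⟩
    sum g        ≡⟨ ΣFin≡sum m g ⟨
    ΣFin R m g   ∎

  ΣFin-+ : ∀ m (f g : Fin m → Carrier) → ΣFin R m (λ i → f i + g i) ≈ ΣFin R m f + ΣFin R m g
  ΣFin-+ m f g = begin
    ΣFin R m (λ i → f i + g i)  ≡⟨ ΣFin≡sum m _ ⟩
    sum (λ i → f i + g i)       ≈⟨ ∑-distrib-+ f g ⟩
    sum f + sum g               ≡⟨ ≡.cong₂ _+_ (ΣFin≡sum m f) (ΣFin≡sum m g) ⟨
    ΣFin R m f + ΣFin R m g     ∎

  ΣFin-*ˡ : ∀ m a (f : Fin m → Carrier) → ΣFin R m (λ i → a * f i) ≈ a * ΣFin R m f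
  ΣFin-*ˡ m a f = begin
    ΣFin R m (λ i → a * f i)  ≡⟨ ΣFin≡sum m _ ⟩
    sum (λ i → a * f i)       ≈⟨ *-distribˡ-sum a f ⟨
    a * sum f                 ≡⟨ ≡.cong (a *_) (ΣFin≡sum m f) ⟨
    a * ΣFin R m f            ∎

  ΣFin-remove : ∀ m (i : Fin (suc m)) (f : Fin (suc m) → Carrier) →
    ΣFin R (suc m) f ≈ f i + ΣFin R m (f ∘ Fin.punchIn i)
  ΣFin-remove m i f = begin
    ΣFin R (suc m) f                      ≡⟨ ΣFin≡sum (suc m) f ⟩
    sum f                                 ≈⟨ sum-remove f ⟩
    f i + sum (f ∘ Fin.punchIn i)         ≡⟨ ≡.cong (_+_ (f i)) (ΣFin≡sum m _) ⟨
    f i + ΣFin R m (f ∘ Fin.punchIn i)    ∎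

  ΣFin-difference : ∀ m (f g : Fin m → Carrier) → ΣFin R m (λ i → f i - g i) ≈ ΣFin R m f - ΣFin R m g
  ΣFin-difference m f g = begin
    ΣFin R m (λ i → f i - g i)               ≈⟨ ΣFin-+ m f _ ⟩
    ΣFin R m f + ΣFin R m (λ i → - g i)      ≈⟨ +-congˡ (ΣFin-cong m (λ i → -1*x≈-x (g i))) ⟨
    ΣFin R m f + ΣFin R m (λ i → - 1# * g i) ≈⟨ +-congˡ (ΣFin-*ˡ m (- 1#) g) ⟩
    ΣFin R m f + - 1# * ΣFin R m g           ≈⟨ +-congˡ (-1*x≈-x _) ⟩
    ΣFin R m f - ΣFin R m g                  ∎

  -- Σ_{a ≠ x} G a, in the form it takes inside neighbourSum.
  otherValues : ∀ {m} → (Fin m → Carrier) → Fin m → Carrier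
  otherValues {m} G x = ΣFin R m (λ a → if does (a Fin.≟ x) then 0# else G a)

  otherValues-complete : ∀ {m} (G : Fin m → Carrier) x → otherValues G x + G x ≈ ΣFin R m G
  otherValues-complete {suc m} G Fin.zero = begin
    (0# + ΣFin R m (G ∘ Fin.suc)) + G Fin.zero  ≈⟨ +-congʳ (+-identityˡ _) ⟩
    ΣFin R m (G ∘ Fin.suc) + G Fin.zero         ≈⟨ +-comm _ _ ⟩
    G Fin.zero + ΣFin R m (G ∘ Fin.suc)         ∎
  otherValues-complete {suc m} G (Fin.suc x) =
    trans (+-assoc _ _ _) (+-congˡ (otherValues-complete (G ∘ Fin.suc) x))

  ΣFin-const : ∀ m x → ΣFin R m (λ _ → x) ≈ natCast R m * x
  ΣFin-const m x = begin
    ΣFin R m (λ _ → x)     ≡⟨ ΣFin≡sum m _ ⟩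
    sum {m} (λ _ → x)      ≈⟨ sum-replicate m ⟩
    m × x                  ≈⟨ ×-congʳ m (*-identityˡ x) ⟨
    m × (1# * x)           ≈⟨ ×-assoc-* m 1# x ⟨
    (m × 1#) * x           ≈⟨ *-congʳ (natCast≈× m) ⟨
    natCast R m * x        ∎

level-up : ∀ w j → w ≡ j ℤ.- 1ℤ → 1ℤ ℤ.+ w ≡ j
level-up w j ≡.refl = one-plus-pred j
  where
  one-plus-pred : ∀ j → 1ℤ ℤ.+ (j ℤ.- 1ℤ) ≡ j
  one-plus-pred = solve-∀

level-down : ∀ w j → 1ℤ ℤ.+ w ≡ j → w ≡ j ℤ.- 1ℤ
level-down w j ≡.refl = pred-of-suc w
  where
  pred-of-suc : ∀ w → w ≡ (1ℤ ℤ.+ w) ℤ.- 1ℤ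
  pred-of-suc = solve-∀

module BooleanWords where

  weightB : ∀ {n} → Vec Bool n → ℕ
  weightB []          = 0
  weightB (false ∷ S) = weightB S
  weightB (true ∷ S)  = suc (weightB S)

  words : ∀ n → List (Vec Bool n)
  words zero    = [] ∷ []
  words (suc n) = List.map (false ∷_) (words n) ++ List.map (true ∷_) (words n)

  words-complete : ∀ {a} {n} (P : Vec Bool n → Set a) → All P (words n) → ∀ T → P T
  words-complete {n = zero}  P (P[] ∷ []) [] = P[]
  words-complete {n = suc n} P all-P (false ∷ T) =
    words-complete (P ∘ (false ∷_)) (AllP.map⁻ (AllP.++⁻ˡ (List.map (false ∷_) (words n)) all-P)) T
  words-complete {n = suc n} P all-P (true ∷ T) =
    words-complete (P ∘ (true ∷_)) (AllP.map⁻ (AllP.++⁻ʳ (List.map (false ∷_) (words n)) all-P)) T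

  tensor : (Bool → Bool → ℤ) → ∀ {n} → Vec Bool n → Vec Bool n → ℤ
  tensor A []      []      = 1ℤ
  tensor A (s ∷ S) (t ∷ T) = A s t ℤ.* tensor A S T

  -- Being of weight j, decided coordinate by coordinate, so that the
  -- decision for true ∷ S is literally the decision for S at level j - 1.
  OnLevel : ∀ {n} → ℤ → Vec Bool n → Set
  OnLevel j S = + weightB S ≡ j

  onLevel? : ∀ {n} (j : ℤ) (S : Vec Bool n) → Dec (OnLevel j S)
  onLevel? j []          = + 0 ℤ.≟ j
  onLevel? j (false ∷ S) = onLevel? j S
  onLevel? j (true ∷ S)  = map′ (level-up (+ weightB S) j) (level-down (+ weightB S) j) (onLevel? (j ℤ.- 1ℤ) S)

-- Functions on the Boolean cube and the "support operator", which is what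
-- the adjacency operator of the Hamming graph becomes on functions that
-- depend only on the support of a word (q = p + 1).  The Kronecker power
-- of the 2×2 matrix ((1, p), (1, -1)) diagonalises it, with eigenvalue
-- p·n - q·w on the row of a word of weight w.  Together with
-- triangularity modulo p this shows that an eigenfunction vanishing on
-- the words of the matching weight vanishes everywhere.
module BooleanCube {c ℓ : Level} (R : CommutativeRing c ℓ) (F0 : IsFieldChar0 R)
                   (p : ℕ) (2≤p : 2 ≤ p) where
  open CommutativeRing R
  open IntegerCast R
  open FieldFacts R F0
  open ListSum R
  open FinSum R
  open Elimination R F0 p 2≤p
  open UnitsModulo p
  open BooleanWords
  open import Relation.Binary.Reasoning.Setoid setoid

  q : ℕ
  q = suc p

  transform : (Bool → Bool → ℤ) → ∀ {n} → (Vec Bool n → Carrier) → Vec Bool n → Carrier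
  transform A {zero}  F []      = F []
  transform A {suc n} F (s ∷ S) =
    transform A (λ T → ι (A s false) * F (false ∷ T) + ι (A s true) * F (true ∷ T)) S

  transform-sum : ∀ A {n} (F : Vec Bool n → Carrier) S →
    transform A F S ≈ ΣL (words n) (λ T → ι (tensor A S T) * F T)
  transform-sum A {zero}  F []      = solve 1 (λ x → x := con 1ℤ :* x :+ con 0ℤ) refl (F [])
  transform-sum A {suc n} F (s ∷ S) = begin
    transform A G S
      ≈⟨ transform-sum A G S ⟩
    ΣL W (λ T → ι (tensor A S T) * G T)
      ≈⟨ ΣL-cong W expand ⟩
    ΣL W (λ T → term (false ∷ T) + term (true ∷ T))
      ≈⟨ ΣL-+ W _ _ ⟩
    ΣL W (term ∘ (false ∷_)) + ΣL W (term ∘ (true ∷_))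
      ≈⟨ +-cong (ΣL-map (false ∷_) W term) (ΣL-map (true ∷_) W term) ⟨
    ΣL (List.map (false ∷_) W) term + ΣL (List.map (true ∷_) W) term
      ≈⟨ ΣL-++ (List.map (false ∷_) W) _ term ⟨
    ΣL (words (suc n)) term ∎
    where
    W = words n
    G : Vec Bool n → Carrier
    G T = ι (A s false) * F (false ∷ T) + ι (A s true) * F (true ∷ T)
    term : Vec Bool (suc n) → Carrier
    term T = ι (tensor A (s ∷ S) T) * F T
    expand : ∀ T → ι (tensor A S T) * G T ≈ term (false ∷ T) + term (true ∷ T)
    expand T = trans
      (solve 5 (λ c a b x y → c :* (a :* x :+ b :* y) := (a :* c) :* x :+ (b :* c) :* y) refl
         (ι (tensor A S T)) (ι (A s false)) (ι (A s true)) (F (false ∷ T)) (F (true ∷ T)))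
      (sym (+-cong (*-congʳ (ι-* (A s false) (tensor A S T))) (*-congʳ (ι-* (A s true) (tensor A S T)))))

  transform-cong : ∀ A {n} {F G : Vec Bool n → Carrier} → (∀ T → F T ≈ G T) → ∀ S → transform A F S ≈ transform A G S
  transform-cong A {zero}  F≈G []      = F≈G []
  transform-cong A {suc n} F≈G (s ∷ S) =
    transform-cong A (λ T → +-cong (*-congˡ (F≈G _)) (*-congˡ (F≈G _))) S

  transform-+ : ∀ A {n} (F G : Vec Bool n → Carrier) S →
    transform A (λ T → F T + G T) S ≈ transform A F S + transform A G S
  transform-+ A {zero}  F G []      = refl
  transform-+ A {suc n} F G (s ∷ S) = trans
    (transform-cong A (λ T → solve 6 (λ a b x y u v → a :* (x :+ u) :+ b :* (y :+ v)
                                         := (a :* x :+ b :* y) :+ (a :* u :+ b :* v)) refl _ _ _ _ _ _) S)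
    (transform-+ A _ _ S)

  transform-*ˡ : ∀ A {n} a (F : Vec Bool n → Carrier) S → transform A (λ T → a * F T) S ≈ a * transform A F S
  transform-*ˡ A {zero}  a F []      = refl
  transform-*ˡ A {suc n} a F (s ∷ S) = trans
    (transform-cong A (λ T → solve 5 (λ c b z x y → b :* (c :* x) :+ z :* (c :* y)
                                         := c :* (b :* x :+ z :* y)) refl _ _ _ _ _) S)
    (transform-*ˡ A a _ S)

  identityKernel : Bool → Bool → ℤ
  identityKernel false false = 1ℤ
  identityKernel false true  = 0ℤ
  identityKernel true  false = 0ℤ
  identityKernel true  true  = 1ℤ

  eigenKernel : Bool → Bool → ℤ
  eigenKernel false false = 1ℤ
  eigenKernel false true  = + p
  eigenKernel true  false = 1ℤ
  eigenKernel true  true  = -1ℤ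

  transform-identity : ∀ {n} (F : Vec Bool n → Carrier) S → transform identityKernel F S ≈ F S
  transform-identity {zero}  F []          = refl
  transform-identity {suc n} F (false ∷ S) = trans (transform-identity _ S)
    (solve 2 (λ x y → con 1ℤ :* x :+ con 0ℤ :* y := x) refl _ _)
  transform-identity {suc n} F (true ∷ S)  = trans (transform-identity _ S)
    (solve 2 (λ x y → con 0ℤ :* x :+ con 1ℤ :* y := y) refl _ _)

  -- A coordinate outside the support can be changed to c₊ = q - 1 nonzero
  -- values; one inside the support to 0 or to c₋ = q - 2 other nonzero values.
  c₊ c₋ : Carrier
  c₊ = natCast R p
  c₋ = natCast R (p ℕ.∸ 1)

  -- c₊ = 1 + c₋, in the form used by the ring solver.
  gap : Carrier
  gap = (ι 1ℤ + c₋) - c₊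

  gap≈0 : gap ≈ 0#
  gap≈0 = begin
    (ι 1ℤ + c₋) - c₊   ≈⟨ +-congʳ (+-congʳ (+-identityʳ 1#)) ⟩
    (1# + c₋) - c₊     ≡⟨ ≡.cong (λ k → natCast R k - c₊) (ℕP.m+[n∸m]≡n (ℕP.<⇒≤ 2≤p)) ⟩
    c₊ - c₊            ≈⟨ -‿inverseʳ c₊ ⟩
    0#                 ∎

  modulo-gap : ∀ {u v} e → u ≈ v + e * gap → u ≈ v
  modulo-gap {u} {v} e u≈v+e·gap = begin
    u              ≈⟨ u≈v+e·gap ⟩
    v + e * gap    ≈⟨ +-congˡ (trans (*-congˡ gap≈0) (zeroʳ e)) ⟩
    v + 0#         ≈⟨ +-identityʳ v ⟩
    v              ∎

  supportTerm : ∀ {n} → (Vec Bool n → Carrier) → Vec Bool n → Fin n → Carrier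
  supportTerm F T i =
    if lookup T i then F (T [ i ]≔ false) + c₋ * F T else c₊ * F (T [ i ]≔ true)

  supportOp : ∀ {n} → (Vec Bool n → Carrier) → Vec Bool n → Carrier
  supportOp {n} F T = ΣFin R n (supportTerm F T)

  supportOp-linear : ∀ {n} a b (G H : Vec Bool n → Carrier) T →
    supportOp (λ T′ → a * G T′ + b * H T′) T ≈ a * supportOp G T + b * supportOp H T
  supportOp-linear {n} a b G H T = begin
    ΣFin R n (supportTerm (λ T′ → a * G T′ + b * H T′) T)
      ≈⟨ ΣFin-cong n termwise ⟩
    ΣFin R n (λ i → a * supportTerm G T i + b * supportTerm H T i)
      ≈⟨ ΣFin-+ n _ _ ⟩
    ΣFin R n (λ i → a * supportTerm G T i) + ΣFin R n (λ i → b * supportTerm H T i)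
      ≈⟨ +-cong (ΣFin-*ˡ n a _) (ΣFin-*ˡ n b _) ⟩
    a * supportOp G T + b * supportOp H T ∎
    where
    termwise : ∀ i → supportTerm (λ T′ → a * G T′ + b * H T′) T i
                     ≈ a * supportTerm G T i + b * supportTerm H T i
    termwise i with lookup T i
    ... | true  = solve 7 (λ a b g h g₀ h₀ c → (a :* g :+ b :* h) :+ c :* (a :* g₀ :+ b :* h₀)
                             := a :* (g :+ c :* g₀) :+ b :* (h :+ c :* h₀))
                    refl a b (G (T [ i ]≔ false)) (H (T [ i ]≔ false)) (G T) (H T) c₋
    ... | false = solve 5 (λ a b g h c → c :* (a :* g :+ b :* h) := a :* (c :* g) :+ b :* (c :* h))
                    refl a b (G (T [ i ]≔ true)) (H (T [ i ]≔ true)) c₊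

  coordinateEigenvalue : Bool → ℤ
  coordinateEigenvalue false = + p
  coordinateEigenvalue true  = -1ℤ

  eigenvalue : ∀ {n} → Vec Bool n → ℤ
  eigenvalue []      = 0ℤ
  eigenvalue (s ∷ S) = coordinateEigenvalue s ℤ.+ eigenvalue S

  -- One coordinate: row s of eigenKernel is a left eigenvector of the
  -- local operator (x, y) ↦ (c₊ y, x + c₋ y).
  coordinate-eigen : ∀ s x y →
    ι (eigenKernel s false) * (c₊ * y) + ι (eigenKernel s true) * (x + c₋ * y)
    ≈ ι (coordinateEigenvalue s) * (ι (eigenKernel s false) * x + ι (eigenKernel s true) * y)
  coordinate-eigen false x y = modulo-gap (c₊ * y)
    (solve 4 (λ c d x y → con 1ℤ :* (c :* y) :+ c :* (x :+ d :* y)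
                := c :* (con 1ℤ :* x :+ c :* y) :+ c :* y :* ((con 1ℤ :+ d) :- c)) refl c₊ c₋ x y)
  coordinate-eigen true x y = modulo-gap (- y)
    (solve 4 (λ c d x y → con 1ℤ :* (c :* y) :+ con -1ℤ :* (x :+ d :* y)
                := con -1ℤ :* (con 1ℤ :* x :+ con -1ℤ :* y) :+ :- y :* ((con 1ℤ :+ d) :- c)) refl c₊ c₋ x y)

  transform-diagonalises : ∀ {n} (F : Vec Bool n → Carrier) S →
    transform eigenKernel (supportOp F) S ≈ ι (eigenvalue S) * transform eigenKernel F S
  transform-diagonalises {zero}  F []      = sym (zeroˡ _)
  transform-diagonalises {suc n} F (s ∷ S) = begin
    transform eigenKernel (λ T → a * supportOp F (false ∷ T) + b * supportOp F (true ∷ T)) S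
      ≈⟨ transform-cong eigenKernel split S ⟩
    transform eigenKernel (λ T → ι ν * G T + supportOp G T) S
      ≈⟨ transform-+ eigenKernel _ _ S ⟩
    transform eigenKernel (λ T → ι ν * G T) S + transform eigenKernel (supportOp G) S
      ≈⟨ +-cong (transform-*ˡ eigenKernel _ G S) (transform-diagonalises G S) ⟩
    ι ν * transform eigenKernel G S + ι (eigenvalue S) * transform eigenKernel G S
      ≈⟨ distribʳ _ _ _ ⟨
    (ι ν + ι (eigenvalue S)) * transform eigenKernel G S
      ≈⟨ *-congʳ (ι-+ ν (eigenvalue S)) ⟨
    ι (eigenvalue (s ∷ S)) * transform eigenKernel G S ∎
    where
    ν = coordinateEigenvalue s
    a = ι (eigenKernel s false)
    b = ι (eigenKernel s true)
    G : Vec Bool n → Carrier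
    G T = a * F (false ∷ T) + b * F (true ∷ T)
    split : ∀ T → a * supportOp F (false ∷ T) + b * supportOp F (true ∷ T) ≈ ι ν * G T + supportOp G T
    split T = begin
      a * (c₊ * y + u) + b * ((x + c₋ * y) + v)
        ≈⟨ solve 8 (λ a b c d x y u v → a :* (c :* y :+ u) :+ b :* ((x :+ d :* y) :+ v)
                      := (a :* (c :* y) :+ b :* (x :+ d :* y)) :+ (a :* u :+ b :* v))
             refl a b c₊ c₋ x y u v ⟩
      (a * (c₊ * y) + b * (x + c₋ * y)) + (a * u + b * v)
        ≈⟨ +-cong (coordinate-eigen s x y) (sym (supportOp-linear a b (F ∘ (false ∷_)) (F ∘ (true ∷_)) T)) ⟩
      ι ν * G T + supportOp G T ∎
      where
      x = F (false ∷ T)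
      y = F (true ∷ T)
      u = supportOp (F ∘ (false ∷_)) T
      v = supportOp (F ∘ (true ∷_)) T

  levelEigenvalue : ℕ → ℤ → ℤ
  levelEigenvalue n j = + p ℤ.* + n ℤ.- + q ℤ.* j

  eigenvalue-level : ∀ {n} (S : Vec Bool n) → eigenvalue S ≡ levelEigenvalue n (+ weightB S)
  eigenvalue-level []          = step-nil (+ p)
    where
    step-nil : ∀ P → 0ℤ ≡ P ℤ.* 0ℤ ℤ.- (1ℤ ℤ.+ P) ℤ.* 0ℤ
    step-nil = solve-∀
  eigenvalue-level {suc n} (false ∷ S) =
    ≡.trans (≡.cong (ℤ._+_ (+ p)) (eigenvalue-level S)) (step-out (+ p) (+ n) (+ weightB S))
    where
    step-out : ∀ P N W → P ℤ.+ (P ℤ.* N ℤ.- (1ℤ ℤ.+ P) ℤ.* W) ≡ P ℤ.* (1ℤ ℤ.+ N) ℤ.- (1ℤ ℤ.+ P) ℤ.* W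
    step-out = solve-∀
  eigenvalue-level {suc n} (true ∷ S) =
    ≡.trans (≡.cong (ℤ._+_ -1ℤ) (eigenvalue-level S)) (step-in (+ p) (+ n) (+ weightB S))
    where
    step-in : ∀ P N W → -1ℤ ℤ.+ (P ℤ.* N ℤ.- (1ℤ ℤ.+ P) ℤ.* W)
                        ≡ P ℤ.* (1ℤ ℤ.+ N) ℤ.- (1ℤ ℤ.+ P) ℤ.* (1ℤ ℤ.+ W)
    step-in = solve-∀

  eigenvalue-off-level : ∀ {n} j (S : Vec Bool n) → ¬ OnLevel j S → eigenvalue S ℤ.- levelEigenvalue n j ≢ 0ℤ
  eigenvalue-off-level {n} j S off difference≡0
    with ℤP.i*j≡0⇒i≡0∨j≡0 (+ q) (≡.trans (≡.sym factor) difference≡0)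
    where
    factor : eigenvalue S ℤ.- levelEigenvalue n j ≡ + q ℤ.* (j ℤ.- + weightB S)
    factor = ≡.trans (≡.cong (ℤ._- levelEigenvalue n j) (eigenvalue-level S))
                     (difference (+ p) (+ n) (+ weightB S) j)
      where
      difference : ∀ P N W J → (P ℤ.* N ℤ.- (1ℤ ℤ.+ P) ℤ.* W) ℤ.- (P ℤ.* N ℤ.- (1ℤ ℤ.+ P) ℤ.* J)
                               ≡ (1ℤ ℤ.+ P) ℤ.* (J ℤ.- W)
      difference = solve-∀
  ... | inj₁ ()
  ... | inj₂ j-w≡0 = off (≡.sym (ℤP.i-j≡0⇒i≡j j (+ weightB S) j-w≡0))

  transform-off-level : ∀ {n} j (F : Vec Bool n → Carrier) →
    (∀ T → supportOp F T ≈ ι (levelEigenvalue n j) * F T) →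
    ∀ S → ¬ OnLevel j S → transform eigenKernel F S ≈ 0#
  transform-off-level {n} j F eigen S off = ι-cancel (eigenvalue-off-level j S off) (begin
    ι (μ ℤ.- Λ) * t                  ≈⟨ *-congʳ (trans (ι-+ μ (ℤ.- Λ)) (+-congˡ (ι-neg Λ))) ⟩
    (ι μ - ι Λ) * t                  ≈⟨ solve 3 (λ a b x → (a :- b) :* x := a :* x :- b :* x) refl (ι μ) (ι Λ) t ⟩
    ι μ * t - ι Λ * t                ≈⟨ +-congʳ (transform-diagonalises F S) ⟨
    transform eigenKernel (supportOp F) S - ι Λ * t
                                     ≈⟨ +-congʳ (transform-cong eigenKernel eigen S) ⟩
    transform eigenKernel (λ T → ι Λ * F T) S - ι Λ * t
                                     ≈⟨ +-congʳ (transform-*ˡ eigenKernel (ι Λ) F S) ⟩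
    ι Λ * t - ι Λ * t                ≈⟨ -‿inverseʳ _ ⟩
    0#                               ∎)
    where
    μ = eigenvalue S
    Λ = levelEigenvalue n j
    t = transform eigenKernel F S

  -- The system combining both facts: the row of a word S on level j is
  -- "F S = 0", every other row is "(eigenbasis transform of F) S = 0".
  kernel : Bool → Bool → Bool → ℤ
  kernel true  = identityKernel
  kernel false = eigenKernel

  levelSystem : ∀ {n} → ℤ → Vec Bool n → Vec Bool n → ℤ
  levelSystem j S = tensor (kernel (does (onLevel? j S))) S

  kernel-diagonal : ∀ b s → Unit (kernel b s s)
  kernel-diagonal true  false = unit-1
  kernel-diagonal true  true  = unit-1
  kernel-diagonal false false = unit-1
  kernel-diagonal false true  = unit--1

  kernel-upper : ∀ b → + p ∣ kernel b false true
  kernel-upper true  = divides 0ℤ ≡.refl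
  kernel-upper false = divides 1ℤ (≡.sym (ℤP.*-identityˡ (+ p)))

  -- Along the enumeration `words`, the level system is triangular modulo
  -- p: rows starting with false (resp. true) are those of the level system
  -- of length n at level j (resp. j - 1), scaled by a unit.
  levelSystem-triangular : ∀ n j → Triangular (levelSystem j) (words n)
  levelSystem-triangular zero    j = unit-1 , [] , tt
  levelSystem-triangular (suc n) j =
    triangular-++ (levelSystem j) (List.map (false ∷_) W) (List.map (true ∷_) W)
      (triangular-map (false ∷_) (levelSystem j) W
        (triangular-scale (λ S → kernel (does (onLevel? j S)) false false) (levelSystem j) W
          (λ S → kernel-diagonal (does (onLevel? j S)) false) (levelSystem-triangular n j)))
      (triangular-map (true ∷_) (levelSystem j) W
        (triangular-scale (λ S → kernel (does (onLevel? (j ℤ.- 1ℤ) S)) true true) (levelSystem (j ℤ.- 1ℤ)) W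
          (λ S → kernel-diagonal (does (onLevel? (j ℤ.- 1ℤ) S)) true) (levelSystem-triangular n (j ℤ.- 1ℤ))))
      (AllP.map⁺ (All.universal (λ S → AllP.map⁺ (All.universal (λ T →
        ∣m⇒∣m*n (tensor (kernel (does (onLevel? j S))) S T) (kernel-upper (does (onLevel? j S)))) W)) W))
    where
    W = words n

  boolean-uniqueness : ∀ n j (F : Vec Bool n → Carrier) →
    (∀ T → supportOp F T ≈ ι (levelEigenvalue n j) * F T) →
    (∀ T → OnLevel j T → F T ≈ 0#) → ∀ T → F T ≈ 0#
  boolean-uniqueness n j F eigen vanishes = words-complete (λ T → F T ≈ 0#)
    (triangular-only-trivial (levelSystem j) (words n) F (levelSystem-triangular n j)
      (All.universal row (words n)))
    where
    row-by-kind : ∀ S (d : Dec (OnLevel j S)) → transform (kernel (does d)) F S ≈ 0#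
    row-by-kind S (yes on)  = trans (transform-identity F S) (vanishes S on)
    row-by-kind S (no off)  = transform-off-level j F eigen S off
    row : ∀ S → ΣL (words n) (λ T → ι (levelSystem j S T) * F T) ≈ 0#
    row S = trans (sym (transform-sum (kernel (does (onLevel? j S))) F S)) (row-by-kind S (onLevel? j S))

insertAt-update : ∀ {A : Set} {n} (β : Vec A n) i (x a : A) → Vec.insertAt β i x [ i ]≔ a ≡ Vec.insertAt β i a
insertAt-update β       Fin.zero    x a = ≡.refl
insertAt-update (b ∷ β) (Fin.suc i) x a = ≡.cong (b ∷_) (insertAt-update β i x a)

insertAt-update-punchIn : ∀ {A : Set} {n} (β : Vec A n) i (x : A) k a →
  Vec.insertAt β i x [ Fin.punchIn i k ]≔ a ≡ Vec.insertAt (β [ k ]≔ a) i x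
insertAt-update-punchIn β       Fin.zero    x k           a = ≡.refl
insertAt-update-punchIn (b ∷ β) (Fin.suc i) x Fin.zero    a = ≡.refl
insertAt-update-punchIn (b ∷ β) (Fin.suc i) x (Fin.suc k) a = ≡.cong (b ∷_) (insertAt-update-punchIn β i x k a)

update-as-insertAt : ∀ {A : Set} {n} (xs : Vec A (suc n)) i (a : A) →
  xs [ i ]≔ a ≡ Vec.insertAt (Vec.removeAt xs i) i a
update-as-insertAt xs i a = ≡.trans
  (≡.cong (_[ i ]≔ a) (≡.sym (VecP.insertAt-removeAt xs i)))
  (insertAt-update (Vec.removeAt xs i) i (lookup xs i) a)

-- The Hamming graph over F_q, q = k + 3, and the main argument.
module HammingGraph {c ℓ : Level} (R : CommutativeRing c ℓ) (F0 : IsFieldChar0 R) (k : ℕ) where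
  open CommutativeRing R
  open IntegerCast R
  open FinSum R
  open BooleanWords
  open BooleanCube R F0 (suc (suc k)) (ℕ.s≤s (ℕ.s≤s ℕ.z≤n))
  open import Algebra.Properties.Ring ring using (x∙y⁻¹≈ε⇒x≈y; x≈y⇒x∙y⁻¹≈ε)
  open import Relation.Binary.Reasoning.Setoid setoid

  Word : ℕ → Set
  Word n = Vec (Fin q) n

  one : Fin q
  one = Fin.suc Fin.zero

  Eigenfunction : ∀ n → ℤ → (Word n → Carrier) → Set ℓ
  Eigenfunction n Λ f = IsLambdaFunction R q n Λ f

  coordinateSum : ∀ {n} → (Word n → Carrier) → Word n → Fin n → Carrier
  coordinateSum f α i = otherValues (λ a → f (α [ i ]≔ a)) (lookup α i)

  neighbourSum-difference : ∀ {n} (G H : Word n → Carrier) α →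
    neighbourSum R (λ β → G β - H β) α ≈ neighbourSum R G α - neighbourSum R H α
  neighbourSum-difference {n} G H α =
    trans (ΣFin-cong n (λ i → trans (ΣFin-cong q (termwise i)) (ΣFin-difference q (value G i) (value H i))))
          (ΣFin-difference n (coordinateSum G α) (coordinateSum H α))
    where
    value : (Word n → Carrier) → Fin n → Fin q → Carrier
    value F i a = if does (a Fin.≟ lookup α i) then 0# else F (α [ i ]≔ a)
    termwise : ∀ i a → value (λ β → G β - H β) i a ≈ value G i a - value H i a
    termwise i a with does (a Fin.≟ lookup α i)
    ... | true  = sym (-‿inverseʳ 0#)
    ... | false = refl

  eigenfunction-difference : ∀ {n Λ} {G H : Word n → Carrier} →
    Eigenfunction n Λ G → Eigenfunction n Λ H → Eigenfunction n Λ (λ β → G β - H β)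
  eigenfunction-difference {Λ = Λ} {G} {H} eigen-G eigen-H β = begin
    neighbourSum R (λ β → G β - H β) β          ≈⟨ neighbourSum-difference G H β ⟩
    neighbourSum R G β - neighbourSum R H β     ≈⟨ +-cong (eigen-G β) (-‿cong (eigen-H β)) ⟩
    ι Λ * G β - ι Λ * H β                       ≈⟨ solve 3 (λ l x y → l :* x :- l :* y := l :* (x :- y)) refl _ _ _ ⟩
    ι Λ * (G β - H β)                           ∎

  Symmetric : ∀ {n} → (Word n → Carrier) → Set ℓ
  Symmetric {n} f = ∀ (xs : Word n) i y z → y ≢ Fin.zero → z ≢ Fin.zero → f (xs [ i ]≔ y) ≈ f (xs [ i ]≔ z)

  weight-insertAt : ∀ {m} (β : Word m) i y → y ≢ Fin.zero → weight (Vec.insertAt β i y) ≡ suc (weight β)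
  weight-insertAt β              i           Fin.zero    y≢0 = ⊥-elim (y≢0 ≡.refl)
  weight-insertAt β              Fin.zero    (Fin.suc y) y≢0 = ≡.refl
  weight-insertAt (Fin.zero ∷ β) (Fin.suc i) (Fin.suc y) y≢0 = weight-insertAt β i (Fin.suc y) y≢0
  weight-insertAt (Fin.suc b ∷ β) (Fin.suc i) (Fin.suc y) y≢0 = ≡.cong suc (weight-insertAt β i (Fin.suc y) y≢0)

  Uniqueness : ℕ → Set (c Level.⊔ ℓ)
  Uniqueness n = ∀ j (f : Word n → Carrier) → Eigenfunction n (levelEigenvalue n j) f →
    (∀ α → + weight α ≡ j → f α ≈ 0#) → ∀ α → f α ≈ 0#

  module Slices {m} (f : Word (suc m) → Carrier) (i : Fin (suc m)) where

    slice : Fin q → Word m → Carrier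
    slice x β = f (Vec.insertAt β i x)

    -- A neighbour of insertAt β i x differs either in coordinate i or in
    -- one of the coordinates of β.
    neighbourSum-slice : ∀ x β →
      neighbourSum R f (Vec.insertAt β i x) ≈ otherValues (λ a → slice a β) x + neighbourSum R (slice x) β
    neighbourSum-slice x β =
      trans (ΣFin-remove m i (coordinateSum f α)) (+-cong at-i (ΣFin-cong m at-others))
      where
      α = Vec.insertAt β i x
      at-i : coordinateSum f α i ≈ otherValues (λ a → slice a β) x
      at-i = ΣFin-cong q (λ a → reflexive (≡.cong₂ (λ l v → if does (a Fin.≟ l) then 0# else f v)
               (VecP.insertAt-lookup β i x) (insertAt-update β i x a)))
      at-others : ∀ k → coordinateSum f α (Fin.punchIn i k) ≈ coordinateSum (slice x) β k
      at-others k = ΣFin-cong q (λ a → reflexive (≡.cong₂ (λ l v → if does (a Fin.≟ l) then 0# else f v)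
               (VecP.insertAt-punchIn β i x k) (insertAt-update-punchIn β i x k a)))

    slice-equation : ∀ {Λ} → Eigenfunction (suc m) Λ f → ∀ x β →
      neighbourSum R (slice x) β ≈ ι Λ * slice x β - (ΣFin R q (λ a → slice a β) - slice x β)
    slice-equation {Λ} eigen x β = begin
      neighbourSum R (slice x) β
        ≈⟨ solve 2 (λ s o → s := (o :+ s) :- o) refl _ (otherValues (λ a → slice a β) x) ⟩
      (otherValues (λ a → slice a β) x + neighbourSum R (slice x) β) - otherValues (λ a → slice a β) x
        ≈⟨ +-cong (sym (neighbourSum-slice x β)) (-‿cong others) ⟩
      neighbourSum R f (Vec.insertAt β i x) - (ΣFin R q (λ a → slice a β) - slice x β)
        ≈⟨ +-congʳ (eigen (Vec.insertAt β i x)) ⟩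
      ι Λ * slice x β - (ΣFin R q (λ a → slice a β) - slice x β) ∎
      where
      others : otherValues (λ a → slice a β) x ≈ ΣFin R q (λ a → slice a β) - slice x β
      others = begin
        otherValues (λ a → slice a β) x
          ≈⟨ solve 2 (λ o s → o := (o :+ s) :- s) refl _ (slice x β) ⟩
        (otherValues (λ a → slice a β) x + slice x β) - slice x β
          ≈⟨ +-congʳ (otherValues-complete (λ a → slice a β) x) ⟩
        ΣFin R q (λ a → slice a β) - slice x β ∎

    slice-difference : ∀ {Λ} → Eigenfunction (suc m) Λ f → ∀ y z →
      Eigenfunction m (Λ ℤ.+ 1ℤ) (λ β → slice y β - slice z β)
    slice-difference {Λ} eigen y z β = begin
      neighbourSum R (λ β → slice y β - slice z β) β
        ≈⟨ neighbourSum-difference (slice y) (slice z) β ⟩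
      neighbourSum R (slice y) β - neighbourSum R (slice z) β
        ≈⟨ +-cong (slice-equation {Λ} eigen y β) (-‿cong (slice-equation {Λ} eigen z β)) ⟩
      (ι Λ * slice y β - (total - slice y β)) - (ι Λ * slice z β - (total - slice z β))
        ≈⟨ solve 4 (λ L t a b → (L :* a :- (t :- a)) :- (L :* b :- (t :- b)) := (L :+ con 1ℤ) :* (a :- b))
             refl (ι Λ) total (slice y β) (slice z β) ⟩
      (ι Λ + ι 1ℤ) * (slice y β - slice z β)
        ≈⟨ *-congʳ (ι-+ Λ 1ℤ) ⟨
      ι (Λ ℤ.+ 1ℤ) * (slice y β - slice z β) ∎
      where
      total = ΣFin R q (λ a → slice a β)

  level-shift : ∀ m j → levelEigenvalue (suc m) j ℤ.+ 1ℤ ≡ levelEigenvalue m (j ℤ.- 1ℤ)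
  level-shift m j = shift (+ p) (+ m) j
    where
    p = suc (suc k)
    shift : ∀ P M J →
      (P ℤ.* (1ℤ ℤ.+ M) ℤ.- (1ℤ ℤ.+ P) ℤ.* J) ℤ.+ 1ℤ ≡ P ℤ.* M ℤ.- (1ℤ ℤ.+ P) ℤ.* (J ℤ.- 1ℤ)
    shift = solve-∀

  -- Induction step, part one: by uniqueness in length m, an eigenfunction
  -- of length m + 1 vanishing on level j is symmetric, since the
  -- difference of two slices at nonzero values y, z is an eigenfunction of
  -- length m and level j - 1 vanishing on that level.
  symmetric-from-shorter : ∀ m → Uniqueness m → ∀ j (f : Word (suc m) → Carrier) →
    Eigenfunction (suc m) (levelEigenvalue (suc m) j) f → (∀ α → + weight α ≡ j → f α ≈ 0#) → Symmetric f
  symmetric-from-shorter m uniqueness j f eigen vanishes xs i y z y≢0 z≢0 = begin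
    f (xs [ i ]≔ y)                      ≡⟨ ≡.cong f (update-as-insertAt xs i y) ⟩
    slice y (Vec.removeAt xs i)
      ≈⟨ x∙y⁻¹≈ε⇒x≈y _ _ (uniqueness (j ℤ.- 1ℤ) _ eigen-d vanishes-d (Vec.removeAt xs i)) ⟩
    slice z (Vec.removeAt xs i)          ≡⟨ ≡.cong f (update-as-insertAt xs i z) ⟨
    f (xs [ i ]≔ z)                      ∎
    where
    open Slices f i
    eigen-d : Eigenfunction m (levelEigenvalue m (j ℤ.- 1ℤ)) (λ β → slice y β - slice z β)
    eigen-d = ≡.subst (λ Λ → Eigenfunction m Λ _) (level-shift m j) (slice-difference {levelEigenvalue (suc m) j} eigen y z)
    on-level : ∀ β x → x ≢ Fin.zero → + weight β ≡ j ℤ.- 1ℤ → + weight (Vec.insertAt β i x) ≡ j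
    on-level β x x≢0 w≡j-1 = ≡.subst (λ w → + w ≡ j) (≡.sym (weight-insertAt β i x x≢0))
      (level-up (+ weight β) j w≡j-1)
    vanishes-d : ∀ β → + weight β ≡ j ℤ.- 1ℤ → slice y β - slice z β ≈ 0#
    vanishes-d β w≡j-1 = begin
      slice y β - slice z β
        ≈⟨ +-cong (vanishes _ (on-level β y y≢0 w≡j-1)) (-‿cong (vanishes _ (on-level β z z≢0 w≡j-1))) ⟩
      0# - 0#                ≈⟨ -‿inverseʳ 0# ⟩
      0#                     ∎

  bit : Bool → Fin q
  bit false = Fin.zero
  bit true  = one

  embed : ∀ {n} → Vec Bool n → Word n
  embed = Vec.map bit

  isNonzero : Fin q → Bool
  isNonzero Fin.zero    = false
  isNonzero (Fin.suc _) = true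

  support : ∀ {n} → Word n → Vec Bool n
  support = Vec.map isNonzero

  weight-embed : ∀ {n} (T : Vec Bool n) → weight (embed T) ≡ weightB T
  weight-embed []          = ≡.refl
  weight-embed (false ∷ T) = weight-embed T
  weight-embed (true ∷ T)  = ≡.cong suc (weight-embed T)

  symmetric-support : ∀ {n} (f : Word n → Carrier) → Symmetric f → ∀ α → f α ≈ f (embed (support α))
  symmetric-support f symmetric []                = refl
  symmetric-support f symmetric (Fin.zero ∷ α)    =
    symmetric-support (f ∘ (Fin.zero ∷_)) (λ xs i → symmetric (Fin.zero ∷ xs) (Fin.suc i)) α
  symmetric-support f symmetric (Fin.suc x ∷ α)   = trans
    (symmetric (Fin.suc x ∷ α) Fin.zero (Fin.suc x) one (λ ()) (λ ()))
    (symmetric-support (f ∘ (one ∷_)) (λ xs i → symmetric (one ∷ xs) (Fin.suc i)) α)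

  -- On a symmetric function the adjacency operator becomes the support
  -- operator: all nonzero values of a changed coordinate give the same
  -- value of f, which only sees whether the coordinate is in the support.
  restriction-eigen : ∀ {n} Λ (f : Word n → Carrier) → Symmetric f → Eigenfunction n Λ f →
    ∀ T → supportOp (f ∘ embed) T ≈ ι Λ * f (embed T)
  restriction-eigen {n} Λ f symmetric eigen T = trans (ΣFin-cong n termwise) (eigen (embed T))
    where
    E = embed T
    lookup-E : ∀ i {b} → lookup T i ≡ b → lookup E i ≡ bit b
    lookup-E i ≡.refl = VecP.lookup-map i bit T
    embed-update : ∀ i b → f (embed (T [ i ]≔ b)) ≈ f (E [ i ]≔ bit b)
    embed-update i b = reflexive (≡.cong f (VecP.map-[]≔ bit T i))
    termwise : ∀ i → supportTerm (f ∘ embed) T i ≈ coordinateSum f E i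
    termwise i with lookup T i in lookup≡
    ... | true = begin
      f (embed (T [ i ]≔ false)) + c₋ * f E
        ≈⟨ +-cong (embed-update i false) (sym (ΣFin-const (suc k) (f E))) ⟩
      f (E [ i ]≔ Fin.zero) + ΣFin R (suc k) (λ _ → f E)
        ≈⟨ +-congˡ (ΣFin-cong (suc k) (λ b → trans E-unchanged (symmetric E i one (Fin.suc (Fin.suc b)) (λ ()) (λ ())))) ⟩
      f (E [ i ]≔ Fin.zero) + ΣFin R (suc k) (λ b → f (E [ i ]≔ Fin.suc (Fin.suc b)))
        ≈⟨ +-congˡ (+-identityˡ _) ⟨
      otherValues (λ a → f (E [ i ]≔ a)) one
        ≡⟨ ≡.cong (otherValues (λ a → f (E [ i ]≔ a))) (lookup-E i lookup≡) ⟨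
      coordinateSum f E i ∎
      where
      E-unchanged : f E ≈ f (E [ i ]≔ one)
      E-unchanged = reflexive (≡.cong f (≡.trans (≡.sym (VecP.[]≔-lookup E i)) (≡.cong (E [ i ]≔_) (lookup-E i lookup≡))))
    ... | false = begin
      c₊ * f (embed (T [ i ]≔ true))
        ≈⟨ *-congˡ (embed-update i true) ⟩
      c₊ * f (E [ i ]≔ one)
        ≈⟨ ΣFin-const (suc (suc k)) _ ⟨
      ΣFin R (suc (suc k)) (λ _ → f (E [ i ]≔ one))
        ≈⟨ ΣFin-cong (suc (suc k)) (λ b → symmetric E i one (Fin.suc b) (λ ()) (λ ())) ⟩
      ΣFin R (suc (suc k)) (λ b → f (E [ i ]≔ Fin.suc b))
        ≈⟨ +-identityˡ _ ⟨
      otherValues (λ a → f (E [ i ]≔ a)) Fin.zero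
        ≡⟨ ≡.cong (otherValues (λ a → f (E [ i ]≔ a))) (lookup-E i lookup≡) ⟨
      coordinateSum f E i ∎

  symmetric-uniqueness : ∀ n j (f : Word n → Carrier) → Symmetric f →
    Eigenfunction n (levelEigenvalue n j) f → (∀ α → + weight α ≡ j → f α ≈ 0#) → ∀ α → f α ≈ 0#
  symmetric-uniqueness n j f symmetric eigen vanishes α = trans (symmetric-support f symmetric α)
    (boolean-uniqueness n j (f ∘ embed) (restriction-eigen (levelEigenvalue n j) f symmetric eigen) vanishes-on-level (support α))
    where
    vanishes-on-level : ∀ T → OnLevel j T → f (embed T) ≈ 0#
    vanishes-on-level T on = vanishes (embed T) (≡.subst (λ w → + w ≡ j) (≡.sym (weight-embed T)) on)

  uniqueness : ∀ n → Uniqueness n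
  uniqueness ℕ.zero  j f eigen vanishes = symmetric-uniqueness ℕ.zero j f (λ _ ()) eigen vanishes
  uniqueness (suc m) j f eigen vanishes =
    symmetric-uniqueness (suc m) j f (symmetric-from-shorter m (uniqueness m) j f eigen vanishes) eigen vanishes

  agreement : ∀ n j (f g : Word n → Carrier) →
    Eigenfunction n (levelEigenvalue n j) f → Eigenfunction n (levelEigenvalue n j) g →
    (∀ α → + weight α ≡ j → f α ≈ g α) → ∀ α → f α ≈ g α
  agreement n j f g eigen-f eigen-g agree α =
    x∙y⁻¹≈ε⇒x≈y (f α) (g α) (uniqueness n j (λ β → f β - g β)
      (eigenfunction-difference {Λ = levelEigenvalue n j} eigen-f eigen-g)
      (λ β w≡j → x≈y⇒x∙y⁻¹≈ε (agree β w≡j)) α)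

-- The statement uses the products of ℕ and the difference of ℤ, which
-- would clash with the ring operations inside the modules above.
open import Data.Nat using (_*_)
open import Data.Integer using (_-_)

-- λ = (q - 1)n - qh is the eigenvalue of level h, so `agreement` applies.
theorem3 : ∀ {c ℓ : Level} (R : CommutativeRing c ℓ) → IsFieldChar0 R →
    (q n h : ℕ) → 2 < q → 1 ≤ n → h ≤ n →
    NonDegenerate q n h →
    (f g : Vec (Fin q) n → CommutativeRing.Carrier R) →
    IsLambdaFunction R q n (+ ((q ∸ 1) * n) - + (q * h)) f →
    IsLambdaFunction R q n (+ ((q ∸ 1) * n) - + (q * h)) g →
    (∀ α → weight α ≡ h → CommutativeRing._≈_ R (f α) (g α)) →
    ∀ α → CommutativeRing._≈_ R (f α) (g α)
theorem3 R F0 q@(suc (suc (suc k))) n h (ℕ.s≤s (ℕ.s≤s (ℕ.s≤s _))) _ _ _ f g eigen-f eigen-g agree =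
  agreement n (+ h) f g (at-level eigen-f) (at-level eigen-g) (λ β w≡h → agree β (ℤP.+-injective w≡h))
  where
  open HammingGraph R F0 k using (Eigenfunction; agreement)
  open BooleanCube R F0 (suc (suc k)) (ℕ.s≤s (ℕ.s≤s ℕ.z≤n)) using (levelEigenvalue)
  at-level : ∀ {e} → Eigenfunction n (+ ((q ∸ 1) * n) - + (q * h)) e → Eigenfunction n (levelEigenvalue n (+ h)) e
  at-level = ≡.subst (λ Λ → Eigenfunction n Λ _) (≡.cong₂ _-_ (ℤP.pos-* (suc (suc k)) n) (ℤP.pos-* q h))
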